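{- Let $n\ge 3$, let $\mathbf{v}=(v_1,\ldots,v_n)$ be positive integers with $v_1\le v_2\le\cdots\le v_n$, and let $\mathbf{k}=(1,1,\ldots,1)$ have length $n$. If there exist $n-2$ mutually orthogonal $v_1\times v_2$ Latin rectangles, then $D(\mathbf{v},\mathbf{k},2)=v_1v_2$.
   Context: Let $X_1,\ldots,X_n$ be pairwise disjoint sets with $|X_i|=v_i$. With $\mathbf{k}=(1,\ldots,1)$, a block is an $n$-tuple $(\{x_1\},\ldots,\{x_n\})$ with $x_i\in X_i$. A $2$-$(\mathbf{v},\mathbf{k},1)$ generalized packing is a family of blocks such that for any $i\ne j$ and any $x\in X_i$, $y\in X_j$, at most one block has $x$ in coordinate $i$ and $y$ in coordinate $j$. $D(\mathbf{v},\mathbf{k},2)$ is the maximum number of blocks in such a generalized packing. A $v_1\times v_2$ Latin rectangle ($v_1\le v_2$) is a $v_1\times v_2$ array on $v_2$ symbols in which each symbol occurs exactly once in each row and at most once in each column. Two such rectangles $L=(\ell_{ij})$, $M=(m_{ij})$ are orthogonal if $(\ell_{ij},m_{ij})=(\ell_{i'j'},m_{i'j'})$ implies $i=i'$ and $j=j'$; a set of rectangles is mutually orthogonal if every two are orthogonal. -}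

module Defs where

open import Data.Nat using (ℕ; zero; suc; _*_; _≤_; s≤s; z≤n)
open import Data.Fin using (Fin; zero; suc)
import Data.Fin as F
open import Data.List using (List; length; lookup)
open import Data.Product using (_×_; ∃)
open import Relation.Binary.PropositionalEquality using (_≡_; _≢_)

-- The point sets are X_i = Fin (v i).  With k = (1,...,1) a block is an
-- n-tuple ({x_1},...,{x_n}), identified with the choice function (x_1,...,x_n).
Block : (n : ℕ) → (Fin n → ℕ) → Set
Block n v = (i : Fin n) → Fin (v i)

IsPacking : (n : ℕ) (v : Fin n → ℕ) → List (Block n v) → Set
IsPacking n v B =
  (p q : Fin (length B)) (i j : Fin n) → i ≢ j →
  (x : Fin (v i)) (y : Fin (v j)) →
  lookup B p i ≡ x → lookup B p j ≡ y →
  lookup B q i ≡ x → lookup B q j ≡ y → p ≡ q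

-- D(v,k,2) = N : N is the maximum size of such a packing
-- (attained, and an upper bound for all packings).
D≡ : (n : ℕ) (v : Fin n → ℕ) → ℕ → Set
D≡ n v N =
  (∃ λ (B : List (Block n v)) → IsPacking n v B × length B ≡ N) ×
  ((B : List (Block n v)) → IsPacking n v B → length B ≤ N)

record LatinRectangle (r c : ℕ) : Set where
  field
    r≤c     : r ≤ c
    entry   : Fin r → Fin c → Fin c
    rowHit  : (i : Fin r) (s : Fin c) → ∃ λ j → entry i j ≡ s
    rowOnce : (i : Fin r) (j j′ : Fin c) → entry i j ≡ entry i j′ → j ≡ j′
    colOnce : (j : Fin c) (i i′ : Fin r) → entry i j ≡ entry i′ j → i ≡ i′
open LatinRectangle public

Orthogonal : {r c : ℕ} → LatinRectangle r c → LatinRectangle r c → Set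
Orthogonal {r} {c} L M =
  (i i′ : Fin r) (j j′ : Fin c) →
  entry L i j ≡ entry L i′ j′ → entry M i j ≡ entry M i′ j′ →
  i ≡ i′ × j ≡ j′

MOLR : ℕ → ℕ → ℕ → Set
MOLR t r c = ∃ λ (L : Fin t → LatinRectangle r c) →
  (a b : Fin t) → a ≢ b → Orthogonal (L a) (L b)

idx₁ : {n : ℕ} → 3 ≤ n → Fin n
idx₁ (s≤s _) = zero

idx₂ : {n : ℕ} → 3 ≤ n → Fin n
idx₂ (s≤s (s≤s _)) = suc zero

module Submission where

-- A block is determined by its first two coordinates in any
-- packing: two blocks agreeing there share a pair (x, y) in coordinates
-- 0 and 1.  Hence every packing has at most v₁ v₂ blocks (in fact at most
-- v_i v_j for any two coordinates i ≠ j).  Conversely, n − 2 mutually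
-- orthogonal v₁ × v₂ Latin rectangles L₀, …, L_{n−3} give the v₁ v₂ blocks
--   (a, b, L₀(a,b), …, L_{n−3}(a,b))      (a < v₁, b < v₂),
-- whose last coordinates fit into X_{k+2} because v₂ ≤ v_{k+2}.  Two such
-- blocks agreeing on two coordinates come from the same cell (a, b): this is
-- trivial for the coordinates 0, 1, follows from the row / column condition
-- of a Latin rectangle when one coordinate is 0 or 1, and from
-- orthogonality when both are Latin coordinates.

open import Defs
open import Data.Nat using (ℕ; _∸_; _*_; _≤_; suc; s≤s; z≤n)
open import Data.Fin using (Fin; zero; suc; inject≤; combine; remQuot; cast)
import Data.Fin as F
open import Data.Fin.Properties
  using (inject≤-injective; combine-remQuot; combine-injective; injective⇒≤; cast-involutive)
open import Data.List using (List; length; lookup; tabulate)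
open import Data.List.Properties using (length-tabulate; lookup-tabulate)
open import Data.Product using (_×_; _,_; ∃; uncurry)
open import Function using (_∘_)
open import Function.Definitions using (Injective)
open import Relation.Binary.PropositionalEquality
open import Data.Empty using (⊥-elim)

Separating : {n : ℕ} {v : Fin n → ℕ} {I : Set} → (I → Block n v) → Set
Separating {n} {I = I} f =
  (s t : I) (i j : Fin n) → i ≢ j → f s i ≡ f t i → f s j ≡ f t j → s ≡ t

separating-∘ : {n : ℕ} {v : Fin n → ℕ} {I J : Set}
  (f : I → Block n v) (σ : J → I) →
  Injective _≡_ _≡_ σ → Separating f → Separating (f ∘ σ)
separating-∘ f σ σ-inj sep s t i j i≢j eᵢ eⱼ = σ-inj (sep (σ s) (σ t) i j i≢j eᵢ eⱼ)

separating⇒packing : {n : ℕ} {v : Fin n → ℕ} (B : List (Block n v)) →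
  Separating (lookup B) → IsPacking n v B
separating⇒packing B sep p q i j i≢j x y refl refl e₃ e₄ = sep p q i j i≢j (sym e₃) (sym e₄)

lookup-tabulate′ : {A : Set} {N : ℕ} (f : Fin N → A) (p : Fin (length (tabulate f))) →
  lookup (tabulate f) p ≡ f (cast (length-tabulate f) p)
lookup-tabulate′ f p =
  subst (λ p′ → lookup (tabulate f) p′ ≡ f (cast (length-tabulate f) p))
        (cast-involutive (sym (length-tabulate f)) (length-tabulate f) p)
        (lookup-tabulate f (cast (length-tabulate f) p))

cast-injective : {m n : ℕ} (eq : m ≡ n) → Injective _≡_ _≡_ (cast eq)
cast-injective eq {p} {q} e =
  trans (sym (cast-involutive (sym eq) eq p))
        (trans (cong (cast (sym eq)) e) (cast-involutive (sym eq) eq q))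

separating-≗ : {n : ℕ} {v : Fin n → ℕ} {I : Set} (f g : I → Block n v) →
  ((s : I) → g s ≡ f s) → Separating f → Separating g
separating-≗ f g g≡f sep s t i j i≢j eᵢ eⱼ = sep s t i j i≢j (transport i eᵢ) (transport j eⱼ)
  where
  transport : (k : Fin _) → g s k ≡ g t k → f s k ≡ f t k
  transport k e = trans (sym (cong (λ b → b k) (g≡f s))) (trans e (cong (λ b → b k) (g≡f t)))

tabulate-packing : {n N : ℕ} {v : Fin n → ℕ} (f : Fin N → Block n v) →
  Separating f → IsPacking n v (tabulate f)
tabulate-packing f sep =
  separating⇒packing (tabulate f)
    (separating-≗ (f ∘ cast (length-tabulate f)) (lookup (tabulate f)) (lookup-tabulate′ f)
      (separating-∘ f (cast (length-tabulate f)) (cast-injective (length-tabulate f)) sep))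

-- Upper bound: in a packing, the pair of entries in two fixed distinct
-- coordinates i, j determines the block, so there are at most v i · v j blocks.
packing-bound : (n : ℕ) (v : Fin n → ℕ) (B : List (Block n v)) → IsPacking n v B →
  (i j : Fin n) → i ≢ j → length B ≤ v i * v j
packing-bound n v B packing i j i≢j = injective⇒≤ {f = pairCode} pairCode-injective
  where
  pairCode : Fin (length B) → Fin (v i * v j)
  pairCode p = combine (lookup B p i) (lookup B p j)

  pairCode-injective : Injective _≡_ _≡_ pairCode
  pairCode-injective {p} {q} e with combine-injective _ _ _ _ e
  ... | eᵢ , eⱼ = packing p q i j i≢j _ _ refl refl (sym eᵢ) (sym eⱼ)

remQuot-injective : {m : ℕ} (k : ℕ) → Injective _≡_ _≡_ (remQuot {m} k)
remQuot-injective {m} k {p} {q} e =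
  trans (sym (combine-remQuot {m} k p))
        (trans (cong (uncurry combine) e) (combine-remQuot {m} k q))

module LatinBlocks {t : ℕ} (v : Fin (suc (suc t)) → ℕ)
  (L : Fin t → LatinRectangle (v zero) (v (suc zero)))
  (orth : (k l : Fin t) → k ≢ l → Orthogonal (L k) (L l))
  (room : (k : Fin t) → v (suc zero) ≤ v (suc (suc k))) where

  Cell : Set
  Cell = Fin (v zero) × Fin (v (suc zero))

  cellBlock : Cell → Block (suc (suc t)) v
  cellBlock (a , b) zero          = a
  cellBlock (a , b) (suc zero)    = b
  cellBlock (a , b) (suc (suc k)) = inject≤ (entry (L k) a b) (room k)

  symbol-agree : (k : Fin t) {a a′ : Fin (v zero)} {b b′ : Fin (v (suc zero))} →
    cellBlock (a , b) (suc (suc k)) ≡ cellBlock (a′ , b′) (suc (suc k)) →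
    entry (L k) a b ≡ entry (L k) a′ b′
  symbol-agree k = inject≤-injective (room k) (room k) _ _

  same-row : (k : Fin t) {a a′ : Fin (v zero)} {b b′ : Fin (v (suc zero))} →
    a ≡ a′ → entry (L k) a b ≡ entry (L k) a′ b′ → (a , b) ≡ (a′ , b′)
  same-row k {a} refl e = cong (a ,_) (rowOnce (L k) a _ _ e)

  same-column : (k : Fin t) {a a′ : Fin (v zero)} {b b′ : Fin (v (suc zero))} →
    b ≡ b′ → entry (L k) a b ≡ entry (L k) a′ b′ → (a , b) ≡ (a′ , b′)
  same-column k {b = b} refl e = cong (_, b) (colOnce (L k) b _ _ e)

  same-symbol-pair : (k l : Fin t) → k ≢ l → {a a′ : Fin (v zero)} {b b′ : Fin (v (suc zero))} →
    entry (L k) a b ≡ entry (L k) a′ b′ → entry (L l) a b ≡ entry (L l) a′ b′ →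
    (a , b) ≡ (a′ , b′)
  same-symbol-pair k l k≢l eₖ eₗ with orth k l k≢l _ _ _ _ eₖ eₗ
  ... | refl , refl = refl

  cellBlock-separating : Separating cellBlock
  cellBlock-separating u w zero zero i≢j _ _ = ⊥-elim (i≢j refl)
  cellBlock-separating u w zero (suc zero) _ e₀ e₁ = cong₂ _,_ e₀ e₁
  cellBlock-separating u w zero (suc (suc k)) _ e₀ eₖ = same-row k e₀ (symbol-agree k eₖ)
  cellBlock-separating u w (suc zero) zero _ e₁ e₀ = cong₂ _,_ e₀ e₁
  cellBlock-separating u w (suc zero) (suc zero) i≢j _ _ = ⊥-elim (i≢j refl)
  cellBlock-separating u w (suc zero) (suc (suc k)) _ e₁ eₖ = same-column k e₁ (symbol-agree k eₖ)
  cellBlock-separating u w (suc (suc k)) zero _ eₖ e₀ = same-row k e₀ (symbol-agree k eₖ)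
  cellBlock-separating u w (suc (suc k)) (suc zero) _ eₖ e₁ = same-column k e₁ (symbol-agree k eₖ)
  cellBlock-separating u w (suc (suc k)) (suc (suc l)) i≢j eₖ eₗ =
    same-symbol-pair k l (λ k≡l → i≢j (cong (λ k → suc (suc k)) k≡l)) (symbol-agree k eₖ) (symbol-agree l eₗ)

  cellPacking : ∃ λ (B : List (Block (suc (suc t)) v)) →
    IsPacking (suc (suc t)) v B × length B ≡ v zero * v (suc zero)
  cellPacking = tabulate cells , tabulate-packing cells cells-separating , length-tabulate cells
    where
    cells : Fin (v zero * v (suc zero)) → Block (suc (suc t)) v
    cells = cellBlock ∘ remQuot (v (suc zero))

    cells-separating : Separating cells
    cells-separating =
      separating-∘ cellBlock (remQuot (v (suc zero))) (remQuot-injective _) cellBlock-separating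

proposition3p15 : (n : ℕ) (h : 3 ≤ n) (v : Fin n → ℕ) →
    ((i : Fin n) → 1 ≤ v i) →
    ((i j : Fin n) → i F.≤ j → v i ≤ v j) →
    MOLR (n ∸ 2) (v (idx₁ h)) (v (idx₂ h)) →
    D≡ n v (v (idx₁ h) * v (idx₂ h))
proposition3p15 (suc (suc (suc m))) (s≤s (s≤s (s≤s _))) v _ monotone (L , orth) =
  cellPacking , λ B packing → packing-bound _ v B packing zero (suc zero) (λ ())
  where
  -- v₂ ≤ v_{k+2} by monotonicity.
  -- Each further coordinate set can hold the symbols.
  room : (k : Fin (suc m)) → v (suc zero) ≤ v (suc (suc k))
  room k = monotone (suc zero) (suc (suc k)) (s≤s z≤n)

  open LatinBlocks v L orth room
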